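{- ($\Sigma$-completeness of $\mathsf{WSeq}$.) For every $\Sigma$-sentence $\phi$ of the language $\{e,\vdash,\circ\}$: if $\mathfrak{S}\models\phi$ then $\mathsf{WSeq}\vdash\phi$.
   Context: Language $\{e,\ \vdash,\ \circ\}$: $e$ constant, $\vdash$ and $\circ$ binary function symbols ($x\vdash y$ is a term, not provability). Sequences are defined inductively: $()$ is a sequence, and if $s_1,\dots,s_n$ ($n>0$) are sequences then $(s_1,\dots,s_n)$ is a sequence. The standard model $\mathfrak{S}$ has as universe all sequences, $e^{\mathfrak S}=()$, $(s_1,\dots,s_n)\vdash^{\mathfrak S}t=(s_1,\dots,s_n,t)$ (append $t$ as a new last element), and $\circ^{\mathfrak S}$ is concatenation: $(s_1,\dots,s_n)\circ(t_1,\dots,t_m)=(s_1,\dots,s_n,t_1,\dots,t_m)$. For a sequence $s$ the sequeral $\overline{s}$ is the closed term with $\overline{()}=e$ and $\overline{(s_1,\dots,s_n)}=(\cdots((e\vdash\overline{s_1})\vdash\overline{s_2})\cdots)\vdash\overline{s_n}$. For terms $t_1,t_2$, $t_1\sqsubseteq t_2$ abbreviates $\exists y[t_1\circ y=t_2]$ and $\forall x\sqsubseteq t[\phi]$ abbreviates $\forall x[x\sqsubseteq t\rightarrow\phi]$. $\Sigma$-formulas are defined inductively: atomic formulas and their negations, and $s\sqsubseteq t$ and $\neg s\sqsubseteq t$ for terms $s,t$, are $\Sigma$; $\Sigma$-formulas are closed under $\wedge$, $\vee$, $\exists x$, and bounded universal quantification $\forall x\sqsubseteq t[\phi]$ where the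 term $t$ does not contain $x$. $\mathsf{WSeq}$ is given by the axiom schemes: ($\mathsf{WSeq}_1$) $\overline{s}\neq\overline{t}$ for all distinct sequences $s,t$; ($\mathsf{WSeq}_2$) $\overline{(s_1,\dots,s_n)}\circ\overline{(t_1,\dots,t_m)}=\overline{(s_1,\dots,s_n,t_1,\dots,t_m)}$ for all sequences; ($\mathsf{WSeq}_3$) $\forall x[x\sqsubseteq\overline{s}\rightarrow\bigvee_{t\in I(s)}x=\overline{t}]$ for each sequence $s$, where $I(s)$ is the set of initial segments of $s$. -}

module Defs where

open import Data.Nat using (ℕ; zero; suc; _<_)
open import Data.List using (List; []; _∷_; _++_; [_]; map; inits)
open import Data.Product using (Σ; _×_; _,_)
open import Data.Sum using (_⊎_)
open import Data.Empty using (⊥)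
open import Data.Unit using (⊤)
open import Relation.Binary.PropositionalEquality using (_≡_; _≢_)

-- Sequences (rose trees): () = sq [], (s₁,…,sₙ) = sq (s₁ ∷ … ∷ sₙ ∷ [])

data Seq : Set where
  sq : List Seq → Seq

infixl 7 _⊢ₜ_ _∘ₜ_

data Term : Set where
  var  : ℕ → Term
  e    : Term
  _⊢ₜ_ : Term → Term → Term
  _∘ₜ_ : Term → Term → Term

infix  5 _≐_
infixr 4 _∧'_
infixr 3 _∨'_
infixr 2 _⇒_

data Formula : Set where
  _≐_  : Term → Term → Formula
  ⊥'   : Formula
  _⇒_  : Formula → Formula → Formula
  _∧'_ : Formula → Formula → Formula
  _∨'_ : Formula → Formula → Formula
  ∀'   : Formula → Formula
  ∃'   : Formula → Formula

¬' : Formula → Formula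
¬' φ = φ ⇒ ⊥'

Ren : Set
Ren = ℕ → ℕ

Sub : Set
Sub = ℕ → Term

extR : Ren → Ren
extR r zero    = zero
extR r (suc n) = suc (r n)

renₜ : Ren → Term → Term
renₜ r (var n)  = var (r n)
renₜ r e        = e
renₜ r (s ⊢ₜ t) = renₜ r s ⊢ₜ renₜ r t
renₜ r (s ∘ₜ t) = renₜ r s ∘ₜ renₜ r t

↑ₜ : Term → Term
↑ₜ = renₜ suc

extS : Sub → Sub
extS σ zero    = var zero
extS σ (suc n) = ↑ₜ (σ n)

subₜ : Sub → Term → Term
subₜ σ (var n)  = σ n
subₜ σ e        = e
subₜ σ (s ⊢ₜ t) = subₜ σ s ⊢ₜ subₜ σ t
subₜ σ (s ∘ₜ t) = subₜ σ s ∘ₜ subₜ σ t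

sub : Sub → Formula → Formula
sub σ (s ≐ t)  = subₜ σ s ≐ subₜ σ t
sub σ ⊥'       = ⊥'
sub σ (φ ⇒ ψ)  = sub σ φ ⇒ sub σ ψ
sub σ (φ ∧' ψ) = sub σ φ ∧' sub σ ψ
sub σ (φ ∨' ψ) = sub σ φ ∨' sub σ ψ
sub σ (∀' φ)   = ∀' (sub (extS σ) φ)
sub σ (∃' φ)   = ∃' (sub (extS σ) φ)

↑ : Formula → Formula
↑ = sub (λ n → var (suc n))

_⟪_⟫ : Formula → Term → Formula
φ ⟪ t ⟫ = sub σ φ
  where
  σ : Sub
  σ zero    = t
  σ (suc n) = var n

-- Abbreviations  t₁ ⊑ t₂  :=  ∃y [t₁ ∘ y = t₂],
--                ∀x ⊑ t [φ] :=  ∀x [x ⊑ t → φ]   (x = var 0, not in t)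

infix 5 _⊑_

_⊑_ : Term → Term → Formula
s ⊑ t = ∃' (↑ₜ s ∘ₜ var zero ≐ ↑ₜ t)

∀⊑ : Term → Formula → Formula
∀⊑ t φ = ∀' (var zero ⊑ ↑ₜ t ⇒ φ)

data IsΣ : Formula → Set where
  atom   : ∀ s t → IsΣ (s ≐ t)
  natom  : ∀ s t → IsΣ (¬' (s ≐ t))
  sqs    : ∀ s t → IsΣ (s ⊑ t)
  nsqs   : ∀ s t → IsΣ (¬' (s ⊑ t))
  and    : ∀ {φ ψ} → IsΣ φ → IsΣ ψ → IsΣ (φ ∧' ψ)
  or     : ∀ {φ ψ} → IsΣ φ → IsΣ ψ → IsΣ (φ ∨' ψ)
  ex     : ∀ {φ} → IsΣ φ → IsΣ (∃' φ)
  ball   : ∀ {φ} t → IsΣ φ → IsΣ (∀⊑ t φ)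

WFₜ : ℕ → Term → Set
WFₜ k (var n)  = n < k
WFₜ k e        = ⊤
WFₜ k (s ⊢ₜ t) = WFₜ k s × WFₜ k t
WFₜ k (s ∘ₜ t) = WFₜ k s × WFₜ k t

WF : ℕ → Formula → Set
WF k (s ≐ t)  = WFₜ k s × WFₜ k t
WF k ⊥'       = ⊤
WF k (φ ⇒ ψ)  = WF k φ × WF k ψ
WF k (φ ∧' ψ) = WF k φ × WF k ψ
WF k (φ ∨' ψ) = WF k φ × WF k ψ
WF k (∀' φ)   = WF (suc k) φ
WF k (∃' φ)   = WF (suc k) φ

Sentence : Formula → Set
Sentence = WF zero

appendS : Seq → Seq → Seq
appendS (sq xs) t = sq (xs ++ [ t ])

concatS : Seq → Seq → Seq
concatS (sq xs) (sq ys) = sq (xs ++ ys)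

Env : Set
Env = ℕ → Seq

_∷ₑ_ : Seq → Env → Env
(d ∷ₑ ρ) zero    = d
(d ∷ₑ ρ) (suc n) = ρ n

⟦_⟧ₜ : Term → Env → Seq
⟦ var n ⟧ₜ ρ  = ρ n
⟦ e ⟧ₜ ρ      = sq []
⟦ s ⊢ₜ t ⟧ₜ ρ = appendS (⟦ s ⟧ₜ ρ) (⟦ t ⟧ₜ ρ)
⟦ s ∘ₜ t ⟧ₜ ρ = concatS (⟦ s ⟧ₜ ρ) (⟦ t ⟧ₜ ρ)

_⊨_ : Env → Formula → Set
ρ ⊨ (s ≐ t)  = ⟦ s ⟧ₜ ρ ≡ ⟦ t ⟧ₜ ρ
ρ ⊨ ⊥'       = ⊥
ρ ⊨ (φ ⇒ ψ)  = ρ ⊨ φ → ρ ⊨ ψ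
ρ ⊨ (φ ∧' ψ) = ρ ⊨ φ × ρ ⊨ ψ
ρ ⊨ (φ ∨' ψ) = ρ ⊨ φ ⊎ ρ ⊨ ψ
ρ ⊨ (∀' φ)   = (d : Seq) → (d ∷ₑ ρ) ⊨ φ
ρ ⊨ (∃' φ)   = Σ Seq λ d → (d ∷ₑ ρ) ⊨ φ

-- truth in 𝔖 (for sentences the environment is irrelevant)
𝔖⊨ : Formula → Set
𝔖⊨ φ = (λ _ → sq []) ⊨ φ

mutual
  num : Seq → Term
  num (sq xs) = numL e xs

  numL : Term → List Seq → Term
  numL acc []       = acc
  numL acc (x ∷ xs) = numL (acc ⊢ₜ num x) xs

⋁ : List Formula → Formula
⋁ []           = ⊥'
⋁ (φ ∷ [])     = φ
⋁ (φ ∷ ψ ∷ φs) = φ ∨' ⋁ (ψ ∷ φs)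

I : Seq → List Seq
I (sq xs) = map sq (inits xs)

data WSeq : Formula → Set where
  wseq₁ : ∀ s t → s ≢ t → WSeq (¬' (num s ≐ num t))
  wseq₂ : ∀ ss ts → WSeq (num (sq ss) ∘ₜ num (sq ts) ≐ num (sq (ss ++ ts)))
  wseq₃ : ∀ s → WSeq (∀⊑ (num s) (⋁ (map (λ t → var zero ≐ num t) (I s))))

infix 1 _⊢_

data _⊢_ (T : Formula → Set) : Formula → Set where
  ax    : ∀ {φ} → T φ → T ⊢ φ
  mp    : ∀ {φ ψ} → T ⊢ (φ ⇒ ψ) → T ⊢ φ → T ⊢ ψ
  gen   : ∀ {φ} → T ⊢ φ → T ⊢ ∀' φ
  ak    : ∀ {φ ψ} → T ⊢ (φ ⇒ ψ ⇒ φ)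
  as    : ∀ {φ ψ χ} → T ⊢ ((φ ⇒ ψ ⇒ χ) ⇒ (φ ⇒ ψ) ⇒ φ ⇒ χ)
  ∧i    : ∀ {φ ψ} → T ⊢ (φ ⇒ ψ ⇒ φ ∧' ψ)
  ∧e₁   : ∀ {φ ψ} → T ⊢ (φ ∧' ψ ⇒ φ)
  ∧e₂   : ∀ {φ ψ} → T ⊢ (φ ∧' ψ ⇒ ψ)
  ∨i₁   : ∀ {φ ψ} → T ⊢ (φ ⇒ φ ∨' ψ)
  ∨i₂   : ∀ {φ ψ} → T ⊢ (ψ ⇒ φ ∨' ψ)
  ∨e    : ∀ {φ ψ χ} → T ⊢ ((φ ⇒ χ) ⇒ (ψ ⇒ χ) ⇒ φ ∨' ψ ⇒ χ)
  ⊥e    : ∀ {φ} → T ⊢ (⊥' ⇒ φ)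
  dne   : ∀ {φ} → T ⊢ (¬' (¬' φ) ⇒ φ)
  ∀e    : ∀ {φ} t → T ⊢ (∀' φ ⇒ φ ⟪ t ⟫)
  ∃i    : ∀ {φ} t → T ⊢ (φ ⟪ t ⟫ ⇒ ∃' φ)
  ∀dist : ∀ {φ ψ} → T ⊢ (∀' (↑ ψ ⇒ φ) ⇒ ψ ⇒ ∀' φ)
  ∃e    : ∀ {φ ψ} → T ⊢ (∀' (φ ⇒ ↑ ψ) ⇒ ∃' φ ⇒ ψ)
  refl≐ : ∀ t → T ⊢ (t ≐ t)
  leib  : ∀ {φ} s t → T ⊢ (s ≐ t ⇒ φ ⟪ s ⟫ ⇒ φ ⟪ t ⟫)

-- Replace every free variable by the sequeral of its value and argue by induction on the
-- Σ-formula.  WSeq proves each such closed term equal to the sequeral of its value (⊢ acts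
-- on sequerals syntactically, ∘ is computed by WSeq₂), which settles the atoms; false
-- equations are refuted by WSeq₁, and existentials, s ⊑ t included, are witnessed by
-- sequerals.  The two universal constructs, ¬ s ⊑ t and ∀x ⊑ t, are reduced by WSeq₃ to the
-- finitely many initial segments of the value of t, each handled by WSeq₁ or by induction.

module Submission where

open import Defs
open import Algebra.Definitions.RawMagma as RawMagma using ()
open import Data.List using ([]; _∷_; _++_; [_]; map)
open import Data.List.Membership.Propositional using (_∈_)
open import Data.List.Membership.Propositional.Properties using (∈-map⁻)
import Data.List.Relation.Binary.Pointwise as Pointwise
open import Data.List.Relation.Binary.Prefix.Heterogeneous.Properties using (inits⁺)
open import Data.List.Relation.Binary.Prefix.Propositional.Properties using (Prefix-as-∣ˡ)
open import Data.List.Relation.Unary.All using (lookup)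
open import Data.List.Relation.Unary.Any using (here; there)
open import Data.Nat using (ℕ; zero; suc; _<_; s≤s)
open import Data.Product using (Σ; _,_)
open import Data.Sum using (inj₁; inj₂)
open import Function using (_∘_)
open import Relation.Nullary using (¬_)
open import Relation.Binary.PropositionalEquality
  using (_≡_; _≢_; _≗_; refl; sym; trans; cong; cong₂; subst; subst₂)

private
  variable
    σ τ : Sub

infixr 5 _∷ₛ_

_∷ₛ_ : Term → Sub → Sub
(t ∷ₛ σ) zero    = t
(t ∷ₛ σ) (suc n) = σ n

sub₀ : Term → Sub
sub₀ t = t ∷ₛ var

subₜ-cong : σ ≗ τ → ∀ t → subₜ σ t ≡ subₜ τ t
subₜ-cong σ≗τ (var n)  = σ≗τ n
subₜ-cong σ≗τ e        = refl
subₜ-cong σ≗τ (s ⊢ₜ t) = cong₂ _⊢ₜ_ (subₜ-cong σ≗τ s) (subₜ-cong σ≗τ t)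
subₜ-cong σ≗τ (s ∘ₜ t) = cong₂ _∘ₜ_ (subₜ-cong σ≗τ s) (subₜ-cong σ≗τ t)

extS-cong : σ ≗ τ → extS σ ≗ extS τ
extS-cong σ≗τ zero    = refl
extS-cong σ≗τ (suc n) = cong ↑ₜ (σ≗τ n)

sub-cong : σ ≗ τ → ∀ φ → sub σ φ ≡ sub τ φ
sub-cong σ≗τ (s ≐ t)  = cong₂ _≐_ (subₜ-cong σ≗τ s) (subₜ-cong σ≗τ t)
sub-cong σ≗τ ⊥'       = refl
sub-cong σ≗τ (φ ⇒ ψ)  = cong₂ _⇒_ (sub-cong σ≗τ φ) (sub-cong σ≗τ ψ)
sub-cong σ≗τ (φ ∧' ψ) = cong₂ _∧'_ (sub-cong σ≗τ φ) (sub-cong σ≗τ ψ)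
sub-cong σ≗τ (φ ∨' ψ) = cong₂ _∨'_ (sub-cong σ≗τ φ) (sub-cong σ≗τ ψ)
sub-cong σ≗τ (∀' φ)   = cong ∀' (sub-cong (extS-cong σ≗τ) φ)
sub-cong σ≗τ (∃' φ)   = cong ∃' (sub-cong (extS-cong σ≗τ) φ)

⟪⟫≡sub₀ : ∀ φ t → φ ⟪ t ⟫ ≡ sub (sub₀ t) φ
⟪⟫≡sub₀ φ t = sub-cong (λ { zero → refl ; (suc n) → refl }) φ

subₜ-var : ∀ t → subₜ var t ≡ t
subₜ-var (var n)  = refl
subₜ-var e        = refl
subₜ-var (s ⊢ₜ t) = cong₂ _⊢ₜ_ (subₜ-var s) (subₜ-var t)
subₜ-var (s ∘ₜ t) = cong₂ _∘ₜ_ (subₜ-var s) (subₜ-var t)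

renₜ-as-subₜ : ∀ r t → renₜ r t ≡ subₜ (var ∘ r) t
renₜ-as-subₜ r (var n)  = refl
renₜ-as-subₜ r e        = refl
renₜ-as-subₜ r (s ⊢ₜ t) = cong₂ _⊢ₜ_ (renₜ-as-subₜ r s) (renₜ-as-subₜ r t)
renₜ-as-subₜ r (s ∘ₜ t) = cong₂ _∘ₜ_ (renₜ-as-subₜ r s) (renₜ-as-subₜ r t)

subₜ-renₜ : ∀ σ r t → subₜ σ (renₜ r t) ≡ subₜ (σ ∘ r) t
subₜ-renₜ σ r (var n)  = refl
subₜ-renₜ σ r e        = refl
subₜ-renₜ σ r (s ⊢ₜ t) = cong₂ _⊢ₜ_ (subₜ-renₜ σ r s) (subₜ-renₜ σ r t)
subₜ-renₜ σ r (s ∘ₜ t) = cong₂ _∘ₜ_ (subₜ-renₜ σ r s) (subₜ-renₜ σ r t)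

renₜ-subₜ : ∀ r σ t → renₜ r (subₜ σ t) ≡ subₜ (renₜ r ∘ σ) t
renₜ-subₜ r σ (var n)  = refl
renₜ-subₜ r σ e        = refl
renₜ-subₜ r σ (s ⊢ₜ t) = cong₂ _⊢ₜ_ (renₜ-subₜ r σ s) (renₜ-subₜ r σ t)
renₜ-subₜ r σ (s ∘ₜ t) = cong₂ _∘ₜ_ (renₜ-subₜ r σ s) (renₜ-subₜ r σ t)

subₜ-subₜ : ∀ τ σ t → subₜ τ (subₜ σ t) ≡ subₜ (subₜ τ ∘ σ) t
subₜ-subₜ τ σ (var n)  = refl
subₜ-subₜ τ σ e        = refl
subₜ-subₜ τ σ (s ⊢ₜ t) = cong₂ _⊢ₜ_ (subₜ-subₜ τ σ s) (subₜ-subₜ τ σ t)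
subₜ-subₜ τ σ (s ∘ₜ t) = cong₂ _∘ₜ_ (subₜ-subₜ τ σ s) (subₜ-subₜ τ σ t)

subₜ-sub₀-↑ₜ : ∀ u t → subₜ (sub₀ u) (↑ₜ t) ≡ t
subₜ-sub₀-↑ₜ u t = trans (subₜ-renₜ (sub₀ u) suc t) (subₜ-var t)

subₜ-extS-↑ₜ : ∀ σ t → subₜ (extS σ) (↑ₜ t) ≡ ↑ₜ (subₜ σ t)
subₜ-extS-↑ₜ σ t = trans (subₜ-renₜ (extS σ) suc t) (sym (renₜ-subₜ suc σ t))

subₜ-extS : ∀ τ σ → subₜ (extS τ) ∘ extS σ ≗ extS (subₜ τ ∘ σ)
subₜ-extS τ σ zero    = refl
subₜ-extS τ σ (suc n) = subₜ-extS-↑ₜ τ (σ n)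

sub-sub : ∀ τ σ φ → sub τ (sub σ φ) ≡ sub (subₜ τ ∘ σ) φ
sub-sub τ σ (s ≐ t)  = cong₂ _≐_ (subₜ-subₜ τ σ s) (subₜ-subₜ τ σ t)
sub-sub τ σ ⊥'       = refl
sub-sub τ σ (φ ⇒ ψ)  = cong₂ _⇒_ (sub-sub τ σ φ) (sub-sub τ σ ψ)
sub-sub τ σ (φ ∧' ψ) = cong₂ _∧'_ (sub-sub τ σ φ) (sub-sub τ σ ψ)
sub-sub τ σ (φ ∨' ψ) = cong₂ _∨'_ (sub-sub τ σ φ) (sub-sub τ σ ψ)
sub-sub τ σ (∀' φ)   = cong ∀' (trans (sub-sub (extS τ) (extS σ) φ) (sub-cong (subₜ-extS τ σ) φ))
sub-sub τ σ (∃' φ)   = cong ∃' (trans (sub-sub (extS τ) (extS σ) φ) (sub-cong (subₜ-extS τ σ) φ))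

sub-sub₀-extS : ∀ u σ φ → sub (sub₀ u) (sub (extS σ) φ) ≡ sub (u ∷ₛ σ) φ
sub-sub₀-extS u σ φ = trans (sub-sub (sub₀ u) (extS σ) φ) (sub-cong instantiate φ)
  where
  instantiate : subₜ (sub₀ u) ∘ extS σ ≗ u ∷ₛ σ
  instantiate zero    = refl
  instantiate (suc n) = subₜ-sub₀-↑ₜ u (σ n)

sub-⊑ : ∀ σ s t → sub σ (s ⊑ t) ≡ (subₜ σ s ⊑ subₜ σ t)
sub-⊑ σ s t =
  cong ∃' (cong₂ _≐_ (cong (_∘ₜ var zero) (subₜ-extS-↑ₜ σ s)) (subₜ-extS-↑ₜ σ t))

sub-∀⊑ : ∀ σ t φ → sub σ (∀⊑ t φ) ≡ ∀⊑ (subₜ σ t) (sub (extS σ) φ)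
sub-∀⊑ σ t φ = cong ∀' (cong (_⇒ sub (extS σ) φ)
  (trans (sub-⊑ (extS σ) (var zero) (↑ₜ t)) (cong (var zero ⊑_) (subₜ-extS-↑ₜ σ t))))

sub-⋁-map : ∀ {A : Set} σ (f g : A → Formula) → (∀ x → sub σ (f x) ≡ g x) →
            ∀ xs → sub σ (⋁ (map f xs)) ≡ ⋁ (map g xs)
sub-⋁-map σ f g fg []           = refl
sub-⋁-map σ f g fg (x ∷ [])     = fg x
sub-⋁-map σ f g fg (x ∷ y ∷ xs) = cong₂ _∨'_ (fg x) (sub-⋁-map σ f g fg (y ∷ xs))

FixesBelow : ℕ → Sub → Set
FixesBelow k σ = ∀ n → n < k → σ n ≡ var n

extS-FixesBelow : ∀ {k} → FixesBelow k σ → FixesBelow (suc k) (extS σ)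
extS-FixesBelow fix zero    _         = refl
extS-FixesBelow fix (suc n) (s≤s n<k) = cong ↑ₜ (fix n n<k)

subₜ-WFₜ : ∀ {k} → FixesBelow k σ → ∀ t → WFₜ k t → subₜ σ t ≡ t
subₜ-WFₜ fix (var n)  n<k       = fix n n<k
subₜ-WFₜ fix e        _         = refl
subₜ-WFₜ fix (s ⊢ₜ t) (ws , wt) = cong₂ _⊢ₜ_ (subₜ-WFₜ fix s ws) (subₜ-WFₜ fix t wt)
subₜ-WFₜ fix (s ∘ₜ t) (ws , wt) = cong₂ _∘ₜ_ (subₜ-WFₜ fix s ws) (subₜ-WFₜ fix t wt)

sub-WF : ∀ {k} → FixesBelow k σ → ∀ φ → WF k φ → sub σ φ ≡ φ
sub-WF fix (s ≐ t)  (ws , wt) = cong₂ _≐_ (subₜ-WFₜ fix s ws) (subₜ-WFₜ fix t wt)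
sub-WF fix ⊥'       _         = refl
sub-WF fix (φ ⇒ ψ)  (wφ , wψ) = cong₂ _⇒_ (sub-WF fix φ wφ) (sub-WF fix ψ wψ)
sub-WF fix (φ ∧' ψ) (wφ , wψ) = cong₂ _∧'_ (sub-WF fix φ wφ) (sub-WF fix ψ wψ)
sub-WF fix (φ ∨' ψ) (wφ , wψ) = cong₂ _∨'_ (sub-WF fix φ wφ) (sub-WF fix ψ wψ)
sub-WF fix (∀' φ)   wφ        = cong ∀' (sub-WF (extS-FixesBelow fix) φ wφ)
sub-WF fix (∃' φ)   wφ        = cong ∃' (sub-WF (extS-FixesBelow fix) φ wφ)

mutual
  subₜ-num : ∀ σ x → subₜ σ (num x) ≡ num x
  subₜ-num σ (sq xs) = subₜ-numL σ e xs

  subₜ-numL : ∀ σ acc xs → subₜ σ (numL acc xs) ≡ numL (subₜ σ acc) xs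
  subₜ-numL σ acc []       = refl
  subₜ-numL σ acc (x ∷ xs) = trans (subₜ-numL σ (acc ⊢ₜ num x) xs)
                                   (cong (λ n → numL (subₜ σ acc ⊢ₜ n) xs) (subₜ-num σ x))

↑ₜ-num : ∀ x → ↑ₜ (num x) ≡ num x
↑ₜ-num x = trans (renₜ-as-subₜ suc (num x)) (subₜ-num _ x)

numL-∷ʳ : ∀ acc xs x → numL acc (xs ++ [ x ]) ≡ numL acc xs ⊢ₜ num x
numL-∷ʳ acc []       x = refl
numL-∷ʳ acc (y ∷ xs) x = numL-∷ʳ (acc ⊢ₜ num y) xs x

num-appendS : ∀ S T → num S ⊢ₜ num T ≡ num (appendS S T)
num-appendS (sq xs) T = sym (numL-∷ʳ e xs T)

⟦renₜ⟧ₜ : ∀ r ρ t → ⟦ renₜ r t ⟧ₜ ρ ≡ ⟦ t ⟧ₜ (ρ ∘ r)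
⟦renₜ⟧ₜ r ρ (var n)  = refl
⟦renₜ⟧ₜ r ρ e        = refl
⟦renₜ⟧ₜ r ρ (s ⊢ₜ t) = cong₂ appendS (⟦renₜ⟧ₜ r ρ s) (⟦renₜ⟧ₜ r ρ t)
⟦renₜ⟧ₜ r ρ (s ∘ₜ t) = cong₂ concatS (⟦renₜ⟧ₜ r ρ s) (⟦renₜ⟧ₜ r ρ t)

⟦↑ₜ⟧ₜ : ∀ d ρ t → ⟦ ↑ₜ t ⟧ₜ (d ∷ₑ ρ) ≡ ⟦ t ⟧ₜ ρ
⟦↑ₜ⟧ₜ d ρ = ⟦renₜ⟧ₜ suc (d ∷ₑ ρ)

infix 4 _≼_

_≼_ : Seq → Seq → Set
S ≼ T = Σ Seq λ d → concatS S d ≡ T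

≼⇒⊨⊑ : ∀ ρ s t → ⟦ s ⟧ₜ ρ ≼ ⟦ t ⟧ₜ ρ → ρ ⊨ (s ⊑ t)
≼⇒⊨⊑ ρ s t (d , S∘d≡T) =
  d , trans (cong (λ S → concatS S d) (⟦↑ₜ⟧ₜ d ρ s)) (trans S∘d≡T (sym (⟦↑ₜ⟧ₜ d ρ t)))

∈I⇒≼ : ∀ {S T} → S ∈ I T → S ≼ T
∈I⇒≼ {T = sq xs} S∈IT with ∈-map⁻ sq S∈IT
... | ys , ys∈inits , refl with Prefix-as-∣ˡ (lookup (inits⁺ (Pointwise.refl refl)) ys∈inits)
... | zs RawMagma., ys++zs≡xs = sq zs , cong sq ys++zs≡xs

module Derivations {T : Formula → Set} where

  private
    variable
      φ ψ χ A B : Formula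
      s s′ t t′ : Term

  ⇒-trans : T ⊢ φ ⇒ ψ → T ⊢ ψ ⇒ χ → T ⊢ φ ⇒ χ
  ⇒-trans φψ ψχ = mp (mp as (mp ak ψχ)) φψ

  ⇒-discharge : T ⊢ φ ⇒ ψ ⇒ χ → T ⊢ ψ → T ⊢ φ ⇒ χ
  ⇒-discharge φψχ ψ = mp (mp as φψχ) (mp ak ψ)

  ∀-elim : ∀ t → T ⊢ ∀' φ → T ⊢ sub (sub₀ t) φ
  ∀-elim {φ} t ∀φ = subst (T ⊢_) (⟪⟫≡sub₀ φ t) (mp (∀e t) ∀φ)

  ∃-intro : ∀ t → T ⊢ sub (sub₀ t) φ → T ⊢ ∃' φ
  ∃-intro {φ} t φt = mp (∃i t) (subst (T ⊢_) (sym (⟪⟫≡sub₀ φ t)) φt)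

  ≐-subst⇒ : ∀ φ → sub (sub₀ s) φ ≡ A → sub (sub₀ t) φ ≡ B → T ⊢ s ≐ t ⇒ A ⇒ B
  ≐-subst⇒ {s} {t = t} φ refl refl =
    subst₂ (λ A B → T ⊢ s ≐ t ⇒ A ⇒ B) (⟪⟫≡sub₀ φ s) (⟪⟫≡sub₀ φ t) (leib s t)

  ≐-subst : ∀ φ → sub (sub₀ s) φ ≡ A → sub (sub₀ t) φ ≡ B → T ⊢ s ≐ t → T ⊢ A ⇒ B
  ≐-subst φ φs≡A φt≡B = mp (≐-subst⇒ φ φs≡A φt≡B)

  ≐-sym⇒ : T ⊢ s ≐ t ⇒ t ≐ s
  ≐-sym⇒ {s} {t} = ⇒-discharge (≐-subst⇒ (var zero ≐ ↑ₜ s) (at s) (at t)) (refl≐ s)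
    where
    at : ∀ x → sub (sub₀ x) (var zero ≐ ↑ₜ s) ≡ (x ≐ s)
    at x = cong (x ≐_) (subₜ-sub₀-↑ₜ x s)

  ≐-sym : T ⊢ s ≐ t → T ⊢ t ≐ s
  ≐-sym = mp ≐-sym⇒

  ≐-subst⁻ : ∀ φ → sub (sub₀ s) φ ≡ A → sub (sub₀ t) φ ≡ B → T ⊢ B → T ⊢ s ≐ t ⇒ A
  ≐-subst⁻ φ φs≡A φt≡B b = ⇒-trans ≐-sym⇒ (⇒-discharge (≐-subst⇒ φ φt≡B φs≡A) b)

  ≐-trans : T ⊢ s ≐ t → T ⊢ t ≐ t′ → T ⊢ s ≐ t′
  ≐-trans {s} p q = mp (≐-subst (↑ₜ s ≐ var zero) (at _) (at _) q) p
    where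
    at : ∀ x → sub (sub₀ x) (↑ₜ s ≐ var zero) ≡ (s ≐ x)
    at x = cong (_≐ x) (subₜ-sub₀-↑ₜ x s)

  module _ (R : Term → Term → Formula)
           (sub-R : ∀ σ s t → sub σ (R s t) ≡ R (subₜ σ s) (subₜ σ t)) where

    ≐-replace₂ : T ⊢ s ≐ s′ → T ⊢ t ≐ t′ → T ⊢ R s t ⇒ R s′ t′
    ≐-replace₂ {s} {s′} {t} {t′} p q =
      ⇒-trans (≐-subst (R (var zero) (↑ₜ t)) (atˡ s) (atˡ s′) p)
              (≐-subst (R (↑ₜ s′) (var zero)) (atʳ t) (atʳ t′) q)
      where
      atˡ : ∀ x → sub (sub₀ x) (R (var zero) (↑ₜ t)) ≡ R x t
      atˡ x = trans (sub-R _ _ _) (cong (R x) (subₜ-sub₀-↑ₜ x t))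
      atʳ : ∀ x → sub (sub₀ x) (R (↑ₜ s′) (var zero)) ≡ R s′ x
      atʳ x = trans (sub-R _ _ _) (cong (λ y → R y x) (subₜ-sub₀-↑ₜ x s′))

  ≐-cong : ∀ {u u′} C → subₜ (sub₀ s) C ≡ u → subₜ (sub₀ t) C ≡ u′ → T ⊢ s ≐ t → T ⊢ u ≐ u′
  ≐-cong {s} {t} {u} C Cs≡u Ct≡u′ p =
    mp (≐-subst (↑ₜ u ≐ C) (cong₂ _≐_ (subₜ-sub₀-↑ₜ s u) Cs≡u) (cong₂ _≐_ (subₜ-sub₀-↑ₜ t u) Ct≡u′) p)
       (refl≐ u)

  module _ (_·_ : Term → Term → Term)
           (subₜ-· : ∀ σ s t → subₜ σ (s · t) ≡ subₜ σ s · subₜ σ t) where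

    ≐-cong₂ : T ⊢ s ≐ s′ → T ⊢ t ≐ t′ → T ⊢ s · t ≐ s′ · t′
    ≐-cong₂ {s} {s′} {t} {t′} p q =
      ≐-trans (≐-cong (var zero · ↑ₜ t) (atˡ s) (atˡ s′) p)
              (≐-cong (↑ₜ s′ · var zero) (atʳ t) (atʳ t′) q)
      where
      atˡ : ∀ x → subₜ (sub₀ x) (var zero · ↑ₜ t) ≡ x · t
      atˡ x = trans (subₜ-· _ _ _) (cong (x ·_) (subₜ-sub₀-↑ₜ x t))
      atʳ : ∀ x → subₜ (sub₀ x) (↑ₜ s′ · var zero) ≡ s′ · x
      atʳ x = trans (subₜ-· _ _ _) (cong (_· x) (subₜ-sub₀-↑ₜ x s′))

  ⋁-elim : ∀ {A : Set} (f : A → Formula) χ xs → (∀ x → x ∈ xs → T ⊢ f x ⇒ χ) →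
           T ⊢ ⋁ (map f xs) ⇒ χ
  ⋁-elim f χ []           fx⇒χ = ⊥e
  ⋁-elim f χ (x ∷ [])     fx⇒χ = fx⇒χ x (here refl)
  ⋁-elim f χ (x ∷ y ∷ xs) fx⇒χ =
    mp (mp ∨e (fx⇒χ x (here refl))) (⋁-elim f χ (y ∷ xs) (λ z z∈ → fx⇒χ z (there z∈)))

open Derivations {T = WSeq}

⌜_⌝ : Env → Sub
⌜ ρ ⌝ n = num (ρ n)

↑ₜ-subₜ-⌜⌝ : ∀ ρ t → ↑ₜ (subₜ ⌜ ρ ⌝ t) ≡ subₜ ⌜ ρ ⌝ t
↑ₜ-subₜ-⌜⌝ ρ t = trans (renₜ-subₜ suc ⌜ ρ ⌝ t) (subₜ-cong (↑ₜ-num ∘ ρ) t)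

sub₀-num-extS-⌜⌝ : ∀ ρ d φ → sub (sub₀ (num d)) (sub (extS ⌜ ρ ⌝) φ) ≡ sub ⌜ d ∷ₑ ρ ⌝ φ
sub₀-num-extS-⌜⌝ ρ d φ =
  trans (sub-sub₀-extS (num d) ⌜ ρ ⌝ φ) (sub-cong (λ { zero → refl ; (suc n) → refl }) φ)

sub₀-var₀-extS-⌜⌝ : ∀ ρ φ → sub (sub₀ (var zero)) (sub (extS ⌜ ρ ⌝) φ) ≡ sub (extS ⌜ ρ ⌝) φ
sub₀-var₀-extS-⌜⌝ ρ φ =
  trans (sub-sub₀-extS (var zero) ⌜ ρ ⌝ φ)
        (sub-cong (λ { zero → refl ; (suc n) → sym (↑ₜ-num (ρ n)) }) φ)

num-concatS : ∀ S D → WSeq ⊢ num S ∘ₜ num D ≐ num (concatS S D)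
num-concatS (sq xs) (sq ys) = ax (wseq₂ xs ys)

sequeral-eval : ∀ ρ t → WSeq ⊢ subₜ ⌜ ρ ⌝ t ≐ num (⟦ t ⟧ₜ ρ)
sequeral-eval ρ (var n)  = refl≐ (num (ρ n))
sequeral-eval ρ e        = refl≐ e
sequeral-eval ρ (s ⊢ₜ t) =
  subst (λ u → WSeq ⊢ subₜ ⌜ ρ ⌝ (s ⊢ₜ t) ≐ u) (num-appendS (⟦ s ⟧ₜ ρ) (⟦ t ⟧ₜ ρ))
        (≐-cong₂ _⊢ₜ_ (λ _ _ _ → refl) (sequeral-eval ρ s) (sequeral-eval ρ t))
sequeral-eval ρ (s ∘ₜ t) =
  ≐-trans (≐-cong₂ _∘ₜ_ (λ _ _ _ → refl) (sequeral-eval ρ s) (sequeral-eval ρ t))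
          (num-concatS (⟦ s ⟧ₜ ρ) (⟦ t ⟧ₜ ρ))

wseq₃-at : ∀ S x → WSeq ⊢ x ⊑ num S ⇒ ⋁ (map (λ u → x ≐ num u) (I S))
wseq₃-at S x = subst (WSeq ⊢_) (cong₂ _⇒_ bound disjuncts) (∀-elim x (ax (wseq₃ S)))
  where
  bound : sub (sub₀ x) (var zero ⊑ ↑ₜ (num S)) ≡ (x ⊑ num S)
  bound = trans (sub-⊑ (sub₀ x) (var zero) (↑ₜ (num S))) (cong (x ⊑_) (subₜ-sub₀-↑ₜ x (num S)))
  disjuncts : sub (sub₀ x) (⋁ (map (λ u → var zero ≐ num u) (I S)))
              ≡ ⋁ (map (λ u → x ≐ num u) (I S))
  disjuncts = sub-⋁-map (sub₀ x) _ _ (λ u → cong (x ≐_) (subₜ-num (sub₀ x) u)) (I S)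

≐-complete : ∀ ρ s t → ⟦ s ⟧ₜ ρ ≡ ⟦ t ⟧ₜ ρ → WSeq ⊢ subₜ ⌜ ρ ⌝ s ≐ subₜ ⌜ ρ ⌝ t
≐-complete ρ s t s≡t = ≐-trans (sequeral-eval ρ s)
  (subst (λ S → WSeq ⊢ num S ≐ subₜ ⌜ ρ ⌝ t) (sym s≡t) (≐-sym (sequeral-eval ρ t)))

≢-complete : ∀ ρ s t → ⟦ s ⟧ₜ ρ ≢ ⟦ t ⟧ₜ ρ → WSeq ⊢ ¬' (subₜ ⌜ ρ ⌝ s ≐ subₜ ⌜ ρ ⌝ t)
≢-complete ρ s t s≢t = ⇒-trans
  (≐-replace₂ _≐_ (λ _ _ _ → refl) (sequeral-eval ρ s) (sequeral-eval ρ t)) (ax (wseq₁ _ _ s≢t))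

⋢-complete : ∀ ρ s t → ¬ (⟦ s ⟧ₜ ρ ≼ ⟦ t ⟧ₜ ρ) → WSeq ⊢ ¬' (subₜ ⌜ ρ ⌝ s ⊑ subₜ ⌜ ρ ⌝ t)
⋢-complete ρ s t s⋠t = ⇒-trans (≐-replace₂ _⊑_ sub-⊑ (sequeral-eval ρ s) (sequeral-eval ρ t))
  (⇒-trans (wseq₃-at (⟦ t ⟧ₜ ρ) (num (⟦ s ⟧ₜ ρ))) (⋁-elim _ ⊥' _ refute))
  where
  refute : ∀ u → u ∈ I (⟦ t ⟧ₜ ρ) → WSeq ⊢ num (⟦ s ⟧ₜ ρ) ≐ num u ⇒ ⊥'
  refute u u∈ = ax (wseq₁ (⟦ s ⟧ₜ ρ) u λ { refl → s⋠t (∈I⇒≼ u∈) })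

∃-complete : ∀ ρ φ d → WSeq ⊢ sub ⌜ d ∷ₑ ρ ⌝ φ → WSeq ⊢ sub ⌜ ρ ⌝ (∃' φ)
∃-complete ρ φ d φd = ∃-intro (num d) (subst (WSeq ⊢_) (sym (sub₀-num-extS-⌜⌝ ρ d φ)) φd)

∀⊑-complete : ∀ ρ t φ → (∀ d → d ≼ ⟦ t ⟧ₜ ρ → WSeq ⊢ sub ⌜ d ∷ₑ ρ ⌝ φ) →
              WSeq ⊢ sub ⌜ ρ ⌝ (∀⊑ t φ)
∀⊑-complete ρ t φ φ-below = subst (WSeq ⊢_) (sym (sub-∀⊑ ⌜ ρ ⌝ t φ))
  (gen (⇒-trans bound (⇒-trans (wseq₃-at (⟦ t ⟧ₜ ρ) (var zero)) (⋁-elim _ ψ _ case))))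
  where
  ψ : Formula
  ψ = sub (extS ⌜ ρ ⌝) φ
  bound : WSeq ⊢ var zero ⊑ ↑ₜ (subₜ ⌜ ρ ⌝ t) ⇒ var zero ⊑ num (⟦ t ⟧ₜ ρ)
  bound rewrite ↑ₜ-subₜ-⌜⌝ ρ t = ≐-replace₂ _⊑_ sub-⊑ (refl≐ (var zero)) (sequeral-eval ρ t)
  case : ∀ d → d ∈ I (⟦ t ⟧ₜ ρ) → WSeq ⊢ var zero ≐ num d ⇒ ψ
  case d d∈ = ≐-subst⁻ ψ (sub₀-var₀-extS-⌜⌝ ρ φ) (sub₀-num-extS-⌜⌝ ρ d φ) (φ-below d (∈I⇒≼ d∈))

Σ-complete : ∀ ρ {φ} → IsΣ φ → ρ ⊨ φ → WSeq ⊢ sub ⌜ ρ ⌝ φ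
Σ-complete ρ (atom s t)     s≡t           = ≐-complete ρ s t s≡t
Σ-complete ρ (natom s t)    s≢t           = ≢-complete ρ s t s≢t
Σ-complete ρ (sqs s t)      (d , s∘d≡t)   =
  ∃-complete ρ (↑ₜ s ∘ₜ var zero ≐ ↑ₜ t) d (≐-complete (d ∷ₑ ρ) (↑ₜ s ∘ₜ var zero) (↑ₜ t) s∘d≡t)
Σ-complete ρ (nsqs s t)     s⋢t           =
  subst (λ χ → WSeq ⊢ χ ⇒ ⊥') (sym (sub-⊑ ⌜ ρ ⌝ s t)) (⋢-complete ρ s t (s⋢t ∘ ≼⇒⊨⊑ ρ s t))
Σ-complete ρ (and p q)      (sat₁ , sat₂) = mp (mp ∧i (Σ-complete ρ p sat₁)) (Σ-complete ρ q sat₂)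
Σ-complete ρ (or p q)       (inj₁ sat₁)   = mp ∨i₁ (Σ-complete ρ p sat₁)
Σ-complete ρ (or p q)       (inj₂ sat₂)   = mp ∨i₂ (Σ-complete ρ q sat₂)
Σ-complete ρ (ex {φ} p)     (d , φd)      = ∃-complete ρ φ d (Σ-complete (d ∷ₑ ρ) p φd)
Σ-complete ρ (ball {φ} t p) ∀d⊑t          =
  ∀⊑-complete ρ t φ λ d d≼t →
    Σ-complete (d ∷ₑ ρ) p
      (∀d⊑t d (≼⇒⊨⊑ (d ∷ₑ ρ) (var zero) (↑ₜ t) (subst (d ≼_) (sym (⟦↑ₜ⟧ₜ d ρ t)) d≼t)))

theorem2 : (φ : Formula) → Sentence φ → IsΣ φ → 𝔖⊨ φ → WSeq ⊢ φ
theorem2 φ wf p sat = subst (WSeq ⊢_) (sub-WF (λ _ ()) φ wf) (Σ-complete (λ _ → sq []) p sat)
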